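{- For every integer $t$, the $3\times 3$ matrix $$A=\begin{bmatrix} (16t+1)(2592t^2+288t+7) & (18t+1)(24t+1)(144t+11) & 2\\ (12t+1)(5184t^2+540t+13) & (72t+5)(1296t^2+153t+4) & 3\\ 2 & 3 & 0 \end{bmatrix}$$ satisfies $\det A=1$ and $\det(A^{(3)})=1$.
   Context: For a matrix $A=(a_{ij})$, $A^{(3)}$ denotes the matrix $(a_{ij}^3)$ obtained by replacing each entry of $A$ by its cube. -}

module Defs where

open import Data.Integer using (ℤ; +_; _+_; _-_; _*_)
open import Data.Fin using (Fin; zero; suc)

Mat3 : Set
Mat3 = Fin 3 → Fin 3 → ℤ

i0 i1 i2 : Fin 3
i0 = zero
i1 = suc zero
i2 = suc (suc zero)

det3 : Mat3 → ℤ
det3 M =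
    M i0 i0 * M i1 i1 * M i2 i2
  + M i0 i1 * M i1 i2 * M i2 i0
  + M i0 i2 * M i1 i0 * M i2 i1
  - M i0 i2 * M i1 i1 * M i2 i0
  - M i0 i0 * M i1 i2 * M i2 i1
  - M i0 i1 * M i1 i0 * M i2 i2

cube : ℤ → ℤ
cube x = x * x * x

entrywiseCube : Mat3 → Mat3
entrywiseCube M i j = cube (M i j)

A : ℤ → Mat3
A t zero zero = (+ 16 * t + + 1) * (+ 2592 * t * t + + 288 * t + + 7)
A t zero (suc zero) = (+ 18 * t + + 1) * (+ 24 * t + + 1) * (+ 144 * t + + 11)
A t zero (suc (suc zero)) = + 2
A t (suc zero) zero = (+ 12 * t + + 1) * (+ 5184 * t * t + + 540 * t + + 13)
A t (suc zero) (suc zero) = (+ 72 * t + + 5) * (+ 1296 * t * t + + 153 * t + + 4)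
A t (suc zero) (suc (suc zero)) = + 3
A t (suc (suc zero)) zero = + 2
A t (suc (suc zero)) (suc zero) = + 3
A t (suc (suc zero)) (suc (suc zero)) = + 0

{-# OPTIONS --safe #-}
module Submission where

-- A has the shape [[a, b, 2], [c, d, 3], [2, 3, 0]], and a matrix of that shape with border p, q
-- has determinant pq·b + pq·c − p²·d − q²·a.  Since A^(3) has the same shape with border 2³, 3³,
-- both determinants are power sums of the four numbers x = 6b, y = 6c, z = 4d, w = 9a:
-- det A = x + y − z − w and det A^(3) = x³ + y³ − z³ − w³.  What remains is a polynomial identity
-- in t, in which x − w = 3(12t + 1) and y − z = −2(18t + 1).

open import Defs
open import Data.Integer using (ℤ; +_; _+_; _-_; _*_)
open import Data.Integer.Tactic.RingSolver using (solve-∀)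
open import Data.Fin using (zero; suc)
open import Data.Product using (_×_; _,_)
open import Relation.Binary.PropositionalEquality using (_≡_; cong₂; sym; trans; module ≡-Reasoning)

bordered : (a b c d p q : ℤ) → Mat3
bordered a b c d p q zero          zero          = a
bordered a b c d p q zero          (suc zero)    = b
bordered a b c d p q zero          (suc (suc _)) = p
bordered a b c d p q (suc zero)    zero          = c
bordered a b c d p q (suc zero)    (suc zero)    = d
bordered a b c d p q (suc zero)    (suc (suc _)) = q
bordered a b c d p q (suc (suc _)) zero          = p
bordered a b c d p q (suc (suc _)) (suc zero)    = q
bordered a b c d p q (suc (suc _)) (suc (suc _)) = + 0

det3-bordered : ∀ a b c d p q →
  det3 (bordered a b c d p q) ≡ p * q * b + p * q * c - p * p * d - q * q * a
det3-bordered = leibniz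
  where
  -- Stated with det3 unfolded: the ring solver treats defined functions as opaque atoms.
  leibniz : ∀ a b c d p q →
    a * d * + 0 + b * q * p + p * c * q - p * d * p - a * q * q - b * c * + 0
      ≡ p * q * b + p * q * c - p * p * d - q * q * a
  leibniz = solve-∀

cube-*³ : ∀ x y z → cube (x * y * z) ≡ cube x * cube y * cube z
cube-*³ = expanded
  where
  expanded : ∀ x y z →
    x * y * z * (x * y * z) * (x * y * z) ≡ x * x * x * (y * y * y) * (z * z * z)
  expanded = solve-∀

det3-bordered-cube : ∀ a b c d p q →
  det3 (bordered (cube a) (cube b) (cube c) (cube d) (cube p) (cube q))
    ≡ cube (p * q * b) + cube (p * q * c) - cube (p * p * d) - cube (q * q * a)
det3-bordered-cube a b c d p q = begin
  det3 (bordered (cube a) (cube b) (cube c) (cube d) (cube p) (cube q))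
    ≡⟨ det3-bordered (cube a) (cube b) (cube c) (cube d) (cube p) (cube q) ⟩
  cube p * cube q * cube b + cube p * cube q * cube c
    - cube p * cube p * cube d - cube q * cube q * cube a
    ≡⟨ sym (cong₂ _-_ (cong₂ _-_ (cong₂ _+_ (cube-*³ p q b) (cube-*³ p q c))
                                 (cube-*³ p p d))
                      (cube-*³ q q a)) ⟩
  cube (p * q * b) + cube (p * q * c) - cube (p * p * d) - cube (q * q * a) ∎
  where open ≡-Reasoning

linear-power-sum : ∀ t →
  let a = (+ 16 * t + + 1) * (+ 2592 * t * t + + 288 * t + + 7)
      b = (+ 18 * t + + 1) * (+ 24 * t + + 1) * (+ 144 * t + + 11)
      c = (+ 12 * t + + 1) * (+ 5184 * t * t + + 540 * t + + 13)
      d = (+ 72 * t + + 5) * (+ 1296 * t * t + + 153 * t + + 4)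
  in + 2 * + 3 * b + + 2 * + 3 * c - + 2 * + 2 * d - + 3 * + 3 * a ≡ + 1
linear-power-sum = solve-∀

cubic-power-sum : ∀ t →
  let a = (+ 16 * t + + 1) * (+ 2592 * t * t + + 288 * t + + 7)
      b = (+ 18 * t + + 1) * (+ 24 * t + + 1) * (+ 144 * t + + 11)
      c = (+ 12 * t + + 1) * (+ 5184 * t * t + + 540 * t + + 13)
      d = (+ 72 * t + + 5) * (+ 1296 * t * t + + 153 * t + + 4)
      x = + 2 * + 3 * b
      y = + 2 * + 3 * c
      z = + 2 * + 2 * d
      w = + 3 * + 3 * a
  in x * x * x + y * y * y - z * z * z - w * w * w ≡ + 1
cubic-power-sum = solve-∀

theorem2p1 : (t : ℤ) → (det3 (A t) ≡ + 1) × (det3 (entrywiseCube (A t)) ≡ + 1)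
theorem2p1 t =
    trans (det3-bordered a b c d (+ 2) (+ 3)) (linear-power-sum t)
  , trans (det3-bordered-cube a b c d (+ 2) (+ 3)) (cubic-power-sum t)
  where
  a b c d : ℤ
  a = A t i0 i0
  b = A t i0 i1
  c = A t i1 i0
  d = A t i1 i1
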